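{- Let $\dot P$ be a diverse colored poset and let $n\in\mathbb{N}$. Then $2n\le \tilde{R}(\dot P,Q_n)\le h(P)\,n+\dim_2(P)$.
   Context: A poset is a set with a reflexive, antisymmetric, transitive relation. $Q_N$ denotes the Boolean lattice of all subsets of an $N$-element set ordered by inclusion. An (induced) copy of a poset $P$ in a poset $Q$ is a subset of $Q$ which, with the order inherited from $Q$, is isomorphic to $P$. A colored poset $\dot P$ is a poset $P$ together with a coloring $c_P\colon P\to\{\text{blue},\text{red}\}$. Given a coloring of $Q$, a copy of $\dot P$ in $Q$ is an induced copy of $P$ in which every vertex has the same color in $Q$ as the corresponding vertex of $\dot P$. $\dot Q_n^{(b)}$ (resp. $\dot Q_n^{(r)}$) denotes $Q_n$ colored entirely blue (resp. red). The poset Erdős–Hajnal number $\tilde{R}(\dot P,Q_n)$ is the minimum $N$ such that every blue/red coloring of $Q_N$ contains a copy of $\dot P$, of $\dot Q_n^{(b)}$, or of $\dot Q_n^{(r)}$. A colored poset is diverse if it contains two comparable vertices of distinct colors. The height $h(P)$ is the size of a largest chain in $P$, and the 2-dimension $\dim_2(P)$ is the smallest $N$ such that $Q_N$ contains an induced copy of $P$. -}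

module Defs where

open import Data.Nat using (ℕ; _≤_)
open import Data.Fin using (Fin)
open import Data.Fin.Subset using (Subset; _⊆_)
open import Data.Product using (Σ; ∃; _×_; _,_)
open import Data.Sum using (_⊎_)
open import Relation.Binary.PropositionalEquality using (_≡_; _≢_)
open import Relation.Binary.Structures using (IsPartialOrder)
open import Function.Definitions using (Injective)
open import Function.Bundles using (_⇔_)

data Color : Set where
  blue red : Color

record ColoredPoset : Set₁ where
  field
    size    : ℕ
    _≼_     : Fin size → Fin size → Set
    isPO    : IsPartialOrder _≡_ _≼_
    colour  : Fin size → Color

-- The Boolean lattice Q_N: carrier Subset N, ordered by inclusion _⊆_.
-- A coloring of Q_N.
Coloring : ℕ → Set
Coloring N = Subset N → Color

IsInducedCopy : {A : Set} (_≤A_ : A → A → Set) {N : ℕ} → (A → Subset N) → Set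
IsInducedCopy {A} _≤A_ f = Injective _≡_ _≡_ f × (∀ (x y : A) → (x ≤A y) ⇔ (f x ⊆ f y))

ContainsCopy : (N : ℕ) (P : ColoredPoset) → Set
ContainsCopy N P = Σ (Fin (ColoredPoset.size P) → Subset N) λ f →
  IsInducedCopy (ColoredPoset._≼_ P) f

ContainsColoredCopy : {N : ℕ} (c : Coloring N) (P : ColoredPoset) → Set
ContainsColoredCopy {N} c P = Σ (Fin (ColoredPoset.size P) → Subset N) λ f →
  IsInducedCopy (ColoredPoset._≼_ P) f × (∀ x → c (f x) ≡ ColoredPoset.colour P x)

ContainsMonoQ : {N : ℕ} (c : Coloring N) (n : ℕ) (k : Color) → Set
ContainsMonoQ {N} c n k = Σ (Subset n → Subset N) λ g →
  IsInducedCopy (_⊆_ {n}) g × (∀ A → c (g A) ≡ k)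

EHProperty : (P : ColoredPoset) (n N : ℕ) → Set
EHProperty P n N = (c : Coloring N) →
  ContainsColoredCopy c P ⊎ (ContainsMonoQ c n blue ⊎ ContainsMonoQ c n red)

Diverse : ColoredPoset → Set
Diverse P = ∃ λ x → ∃ λ y → ColoredPoset._≼_ P x y ×
  ColoredPoset.colour P x ≢ ColoredPoset.colour P y

Chain : (P : ColoredPoset) (k : ℕ) → Set
Chain P k = Σ (Fin k → Fin (ColoredPoset.size P)) λ f →
  Injective _≡_ _≡_ f ×
  (∀ i j → ColoredPoset._≼_ P (f i) (f j) ⊎ ColoredPoset._≼_ P (f j) (f i))

IsHeight : ColoredPoset → ℕ → Set
IsHeight P h = Chain P h × (∀ k → Chain P k → k ≤ h)

IsDim2 : ColoredPoset → ℕ → Set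
IsDim2 P d = ContainsCopy d P × (∀ N → ContainsCopy N P → d ≤ N)

-- Lower bound: colour the sets of size < n with the colour of the top vertex y of a
-- diverse pair x ≼ y and all larger sets with the other colour.  A copy of Q_n spans
-- at least n levels, so it can be neither entirely small nor entirely large in Q_N
-- with N < 2n, while a copy of x ≼ y would put the larger set x below the small set y.
--
-- Upper bound: embed P into Q_d by φ and let rank p < h be the length of a longest
-- chain strictly below p.  Give each p the copy S ↦ block (rank p) S ++ φ p of Q_n in
-- Q_{hn+d}, where block r S fills the first r of h blocks of n coordinates and puts S
-- in the next one.  Either one of these copies is monochromatic in the colour opposite
-- to p, or each contains a point of the colour of p; those points form a copy of P,
-- because p ≺ q forces rank p < rank q, and then block (rank p) S ⊆ block (rank q) S'.
{-# OPTIONS --safe #-}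
module Submission where

open import Defs
open import Data.Nat using (ℕ; _≤_; _<_; _+_; _*_)
open import Data.Product using (Σ; _×_)
open import Relation.Nullary using (¬_)

open import Data.Nat using (zero; suc; z≤n; s≤s; _⊔_; _<?_)
import Data.Nat.Properties as ℕ
open import Data.Bool using (true; false)
open import Data.Fin as Fin using (Fin)
open import Data.Fin.Properties using (<-cmp; all?; ¬∀⟶∃¬)
open import Data.Fin.Subset
open import Data.Fin.Subset.Properties
open import Data.Vec using ([]; _∷_; _++_; here)
open import Data.Vec.Properties using (++-injectiveʳ)
open import Data.Product using (_,_; proj₁; proj₂; ∃)
open import Data.Sum using (_⊎_; inj₁; inj₂; [_,_])
open import Relation.Nullary using (Dec; yes; no)
open import Relation.Nullary.Negation using (contradiction)
open import Relation.Unary using (Decidable)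
open import Relation.Binary.PropositionalEquality using (_≡_; _≢_; refl; sym; trans; cong; subst)
open import Relation.Binary.Definitions using (tri<; tri≈; tri>)
open import Relation.Binary.Structures using (IsPartialOrder)
open import Function.Base using (_∘_)
open import Function.Bundles using (Equivalence; mk⇔; _⇔_)
open import Function.Definitions using (Injective)

other : Color → Color
other blue = red
other red  = blue

_≟ᶜ_ : (k κ : Color) → Dec (k ≡ κ)
blue ≟ᶜ blue = yes refl
blue ≟ᶜ red  = no λ ()
red  ≟ᶜ blue = no λ ()
red  ≟ᶜ red  = yes refl

≡⊎≡other : ∀ κ k → κ ≡ k ⊎ κ ≡ other k
≡⊎≡other blue blue = inj₁ refl
≡⊎≡other blue red  = inj₂ refl
≡⊎≡other red  blue = inj₂ refl
≡⊎≡other red  red  = inj₁ refl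

≢⇒≡other : ∀ {κ k} → κ ≢ k → κ ≡ other k
≢⇒≡other {κ} {k} κ≢k with ≡⊎≡other κ k
... | inj₁ κ≡k = contradiction κ≡k κ≢k
... | inj₂ κ≡k̅ = κ≡k̅

other≢ : ∀ k → other k ≢ k
other≢ blue ()
other≢ red  ()

monoQ-blue⊎red : ∀ {N} {c : Coloring N} {n} k →
  ContainsMonoQ c n k → ContainsMonoQ c n blue ⊎ ContainsMonoQ c n red
monoQ-blue⊎red blue = inj₁
monoQ-blue⊎red red  = inj₂

module _ {m} {p q : Subset m} where

  ⊆∧≢⇒⊂ : p ⊆ q → p ≢ q → p ⊂ q
  ⊆∧≢⇒⊂ p⊆q p≢q with p ⊂? q
  ... | yes p⊂q = p⊂q
  ... | no  p⊄q = contradiction (⊆-antisym p⊆q q⊆p) p≢q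
    where
    q⊆p : q ⊆ p
    q⊆p {x} x∈q with x ∈? p
    ... | yes x∈p = x∈p
    ... | no  x∉p = contradiction ((λ {y} → p⊆q {y}) , x , x∈q , x∉p) p⊄q

++-⊆ : ∀ {m k} {a a' : Subset m} {b b' : Subset k} → a ⊆ a' → b ⊆ b' → a ++ b ⊆ a' ++ b'
++-⊆ {a = []}        {[]}         _    b⊆b' = b⊆b'
++-⊆ {a = false ∷ a} {_ ∷ a'}     a⊆a' b⊆b' = out⊆ (++-⊆ (drop-∷-⊆ a⊆a') b⊆b')
++-⊆ {a = true ∷ a}  {true ∷ a'}  a⊆a' b⊆b' = s⊆s (++-⊆ (drop-∷-⊆ a⊆a') b⊆b')
++-⊆ {a = true ∷ a}  {false ∷ a'} a⊆a' _    = contradiction (a⊆a' here) λ ()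

++-⊆⁻ˡ : ∀ {m k} {a a' : Subset m} {b b' : Subset k} → a ++ b ⊆ a' ++ b' → a ⊆ a'
++-⊆⁻ˡ {a = []}        {[]}         _  ()
++-⊆⁻ˡ {a = false ∷ a} {_ ∷ a'}     ⊆' = out⊆ (++-⊆⁻ˡ {a = a} {a'} (drop-∷-⊆ ⊆'))
++-⊆⁻ˡ {a = true ∷ a}  {true ∷ a'}  ⊆' = s⊆s (++-⊆⁻ˡ {a = a} {a'} (drop-∷-⊆ ⊆'))
++-⊆⁻ˡ {a = true ∷ a}  {false ∷ a'} ⊆' = contradiction (⊆' here) λ ()

++-⊆⁻ʳ : ∀ {m k} {a a' : Subset m} {b b' : Subset k} → a ++ b ⊆ a' ++ b' → b ⊆ b'
++-⊆⁻ʳ {a = []}    {[]}     ⊆' = ⊆'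
++-⊆⁻ʳ {a = _ ∷ a} {_ ∷ a'} ⊆' = ++-⊆⁻ʳ {a = a} {a'} (drop-∷-⊆ ⊆')

strictMono⇒⊥+n≤⊤ : ∀ {n} (f : Subset n → ℕ) →
  (∀ {a b} → a ⊂ b → f a < f b) → f ⊥ + n ≤ f ⊤
strictMono⇒⊥+n≤⊤ {zero} f _ = ℕ.≤-reflexive (ℕ.+-identityʳ (f []))
strictMono⇒⊥+n≤⊤ {suc n} f f-mono = begin
  f ⊥ + suc n               ≡⟨ ℕ.+-suc (f ⊥) n ⟩
  suc (f ⊥ + n)             ≤⟨ s≤s (strictMono⇒⊥+n≤⊤ (λ S → f (false ∷ S)) (f-mono ∘ out⊂)) ⟩
  suc (f (false ∷ ⊤))       ≤⟨ f-mono (out⊂in ⊆-refl) ⟩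
  f ⊤                       ∎
  where open ℕ.≤-Reasoning

module InducedCube {n N} {g : Subset n → Subset N} (g-copy : IsInducedCopy _⊆_ g) where

  preserves-⊂ : ∀ {a b} → a ⊂ b → g a ⊂ g b
  preserves-⊂ {a} {b} a⊂b = ⊆∧≢⇒⊂ (Equivalence.to (proj₂ g-copy a b) (proj₁ a⊂b))
    λ ga≡gb → ⊂-irref (proj₁ g-copy ga≡gb) a⊂b

  spans-n-levels : ∣ g ⊥ ∣ + n ≤ ∣ g ⊤ ∣
  spans-n-levels = strictMono⇒⊥+n≤⊤ (λ S → ∣ g S ∣) (p⊂q⇒∣p∣<∣q∣ ∘ preserves-⊂)

choose : {A : Set} → Dec A → Color → Color
choose (yes _) k = k
choose (no  _) k = other k

choose≡⇒holds : ∀ {A : Set} (a? : Dec A) k → choose a? k ≡ k → A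
choose≡⇒holds (yes a) _ _ = a
choose≡⇒holds (no  _) k e = contradiction e (other≢ k)

choose≡other⇒fails : ∀ {A : Set} (a? : Dec A) k → choose a? k ≡ other k → ¬ A
choose≡other⇒fails (yes _) k e = contradiction (sym e) (other≢ k)
choose≡other⇒fails (no ¬a) _ _ = ¬a

module Threshold (n N : ℕ) (k : Color) where

  colouring : Coloring N
  colouring X = choose (∣ X ∣ <? n) k

  small : ∀ X → colouring X ≡ k → ∣ X ∣ < n
  small X = choose≡⇒holds (∣ X ∣ <? n) k

  large : ∀ X → colouring X ≡ other k → n ≤ ∣ X ∣
  large X e = ℕ.≮⇒≥ (choose≡other⇒fails (∣ X ∣ <? n) k e)

  no-monoQ : N < 2 * n → ∀ κ → ¬ ContainsMonoQ colouring n κ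
  no-monoQ N<2n κ (g , g-copy , mono) with ≡⊎≡other κ k
  ... | inj₁ refl = ℕ.<⇒≱ (small (g ⊤) (mono ⊤)) (begin
    n                    ≤⟨ ℕ.m≤n+m n _ ⟩
    ∣ g ⊥ ∣ + n          ≤⟨ spans-n-levels ⟩
    ∣ g ⊤ ∣              ∎)
    where
    open ℕ.≤-Reasoning
    open InducedCube g-copy
  ... | inj₂ refl = ℕ.<⇒≱ N<2n (begin
    2 * n                ≡⟨ cong (n +_) (ℕ.+-identityʳ n) ⟩
    n + n                ≤⟨ ℕ.+-monoˡ-≤ n (large (g ⊥) (mono ⊥)) ⟩
    ∣ g ⊥ ∣ + n          ≤⟨ spans-n-levels ⟩
    ∣ g ⊤ ∣              ≤⟨ ∣p∣≤n (g ⊤) ⟩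
    N                    ∎)
    where
    open ℕ.≤-Reasoning
    open InducedCube g-copy

lower-bound : (P : ColoredPoset) → Diverse P → ∀ n N → N < 2 * n → ¬ EHProperty P n N
lower-bound P (x , y , x≼y , cx≢cy) n N N<2n eh =
  [ no-copy , [ no-monoQ N<2n blue , no-monoQ N<2n red ] ] (eh colouring)
  where
  open ColoredPoset P
  open Threshold n N (colour y)

  no-copy : ¬ ContainsColoredCopy colouring P
  no-copy (f , (_ , f-iso) , f-colour) = ℕ.<⇒≱
    (ℕ.≤-<-trans (p⊆q⇒∣p∣≤∣q∣ (Equivalence.to (f-iso x y) x≼y)) (small (f y) (f-colour y)))
    (large (f x) (trans (f-colour x) (≢⇒≡other cx≢cy)))

max-over : ∀ {k} → (Fin k → ℕ) → ℕ
max-over {zero}  g = 0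
max-over {suc k} g = g Fin.zero ⊔ max-over (g ∘ Fin.suc)

≤-max-over : ∀ {k} (g : Fin k → ℕ) i → g i ≤ max-over g
≤-max-over g Fin.zero    = ℕ.m≤m⊔n _ _
≤-max-over g (Fin.suc i) = ℕ.≤-trans (≤-max-over (g ∘ Fin.suc) i) (ℕ.m≤n⊔m _ _)

max-over-mono : ∀ {k} {g g' : Fin k → ℕ} → (∀ i → g i ≤ g' i) → max-over g ≤ max-over g'
max-over-mono {zero}  _    = z≤n
max-over-mono {suc k} g≤g' = ℕ.⊔-mono-≤ (g≤g' Fin.zero) (max-over-mono (g≤g' ∘ Fin.suc))

max-over-attained : ∀ {k} (g : Fin k → ℕ) → max-over g ≡ 0 ⊎ ∃ λ i → max-over g ≡ g i
max-over-attained {zero}  g = inj₁ refl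
max-over-attained {suc k} g with max-over-attained (g ∘ Fin.suc)
... | inj₁ rest≡0 = inj₂ (Fin.zero , trans (cong (g Fin.zero ⊔_) rest≡0) (ℕ.⊔-identityʳ _))
... | inj₂ (i , rest≡gi) with ℕ.⊔-sel (g Fin.zero) (max-over (g ∘ Fin.suc))
...   | inj₁ max≡g0   = inj₂ (Fin.zero , max≡g0)
...   | inj₂ max≡rest = inj₂ (Fin.suc i , trans max≡rest rest≡gi)

suc-if : {A : Set} → Dec A → ℕ → ℕ
suc-if (yes _) r = suc r
suc-if (no  _) _ = 0

suc-if-mono : {A : Set} (a? : Dec A) {r r' : ℕ} → r ≤ r' → suc-if a? r ≤ suc-if a? r'
suc-if-mono (yes _) r≤r' = s≤s r≤r'
suc-if-mono (no  _) _    = z≤n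

module Rank {s d} (φ : Fin s → Subset d) where

  height : ℕ → Fin s → ℕ
  height zero    p = 0
  height (suc m) p = max-over λ q → suc-if (φ q ⊂? φ p) (height m q)

  height-fuel-mono : ∀ {m m'} p → m ≤ m' → height m p ≤ height m' p
  height-fuel-mono {zero}  p _ = z≤n
  height-fuel-mono {suc m} {suc m'} p (s≤s m≤m') =
    max-over-mono λ q → suc-if-mono (φ q ⊂? φ p) (height-fuel-mono q m≤m')

  -- ∣ φ p ∣ is enough fuel, as each step of a chain descending from p shrinks the set.
  rank : Fin s → ℕ
  rank p = height ∣ φ p ∣ p

  rank-mono : ∀ {p q} → φ q ⊂ φ p → rank q < rank p
  rank-mono {p} {q} q⊂p = suc-rank≤height ∣ φ p ∣ (p⊂q⇒∣p∣<∣q∣ q⊂p)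
    where
    suc-rank≤height : ∀ m → ∣ φ q ∣ < m → suc (rank q) ≤ height m p
    suc-rank≤height (suc m) (s≤s ∣q∣≤m) with ≤-max-over (λ q' → suc-if (φ q' ⊂? φ p) (height m q')) q
    ... | bound with φ q ⊂? φ p
    ...   | yes _   = ℕ.≤-trans (s≤s (height-fuel-mono q ∣q∣≤m)) bound
    ...   | no  q⊄p = contradiction q⊂p q⊄p

  DescendingFrom : ℕ → Fin s → Set
  DescendingFrom k p = Σ (Fin (suc k) → Fin s) λ c →
    c Fin.zero ≡ p × (∀ {i j} → i Fin.< j → φ (c j) ⊂ φ (c i))

  singleton : ∀ p → DescendingFrom 0 p
  singleton p = (λ _ → p) , refl , λ { {Fin.zero} {Fin.zero} () }

  extend : ∀ {k p p'} → φ p ⊂ φ p' → DescendingFrom k p → DescendingFrom (suc k) p'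
  extend {k} {p' = p'} c₀⊂p' (c , refl , desc) = c' , refl , desc'
    where
    c' : Fin (suc (suc k)) → Fin s
    c' Fin.zero    = p'
    c' (Fin.suc i) = c i

    desc' : ∀ {i j} → i Fin.< j → φ (c' j) ⊂ φ (c' i)
    desc' {Fin.zero}  {Fin.suc Fin.zero}    _       = c₀⊂p'
    desc' {Fin.zero}  {Fin.suc (Fin.suc j)} _       = ⊂-trans (desc {Fin.zero} (s≤s z≤n)) c₀⊂p'
    desc' {Fin.suc i} {Fin.suc j}           (s≤s i<j) = desc i<j

  descendingFrom-height : ∀ m p → DescendingFrom (height m p) p
  descendingFrom-height zero    p = singleton p
  descendingFrom-height (suc m) p with max-over-attained (λ q → suc-if (φ q ⊂? φ p) (height m q))
  ... | inj₁ max≡0 = subst (λ k → DescendingFrom k p) (sym max≡0) (singleton p)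
  ... | inj₂ (q , max≡) = subst (λ k → DescendingFrom k p) (sym max≡)
                                (through (φ q ⊂? φ p) (descendingFrom-height m q))
    where
    through : ∀ {q} (q⊂p? : Dec (φ q ⊂ φ p)) → DescendingFrom (height m q) q →
              DescendingFrom (suc-if q⊂p? (height m q)) p
    through (yes q⊂p) c = extend q⊂p c
    through (no  _)   _ = singleton p

  descendingFrom-rank : ∀ p → DescendingFrom (rank p) p
  descendingFrom-rank p = descendingFrom-height ∣ φ p ∣ p

block : ∀ {n} h → ℕ → Subset n → Subset (h * n)
block zero    _       _ = []
block (suc h) zero    S = S ++ ⊥
block (suc h) (suc r) S = ⊤ ++ block h r S

block-mono : ∀ {n} h r {S S' : Subset n} → S ⊆ S' → block h r S ⊆ block h r S'
block-mono zero    _       _    ()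
block-mono (suc h) zero    S⊆S' = ++-⊆ S⊆S' ⊆-refl
block-mono (suc h) (suc r) S⊆S' = ++-⊆ {a = ⊤} ⊆-refl (block-mono h r S⊆S')

block-< : ∀ {n} h {r r'} {S S' : Subset n} → r < r' → block h r S ⊆ block h r' S'
block-< zero                          _         ()
block-< (suc h) {zero}  {suc r'} {S}  _         = ++-⊆ {a = S} (⊆-max _) (⊆-min _)
block-< (suc h) {suc r} {suc r'}      (s≤s r<r') = ++-⊆ {a = ⊤} ⊆-refl (block-< h r<r')

block-reflects : ∀ {n} h r {S S' : Subset n} → r < h → block h r S ⊆ block h r S' → S ⊆ S'
block-reflects (suc h) zero    {S} _         ⊆' = ++-⊆⁻ˡ {a = S} ⊆'
block-reflects (suc h) (suc r)     (s≤s r<h) ⊆' = block-reflects h r r<h (++-⊆⁻ʳ {a = ⊤} ⊆')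

module Upper (P : ColoredPoset) {n h d : ℕ} (chains-bounded : ∀ k → Chain P k → k ≤ h)
  {φ : Fin (ColoredPoset.size P) → Subset d}
  (φ-copy : IsInducedCopy (ColoredPoset._≼_ P) φ) where

  open ColoredPoset P
  open Rank φ

  φ-injective : Injective _≡_ _≡_ φ
  φ-injective = proj₁ φ-copy

  φ-order : ∀ p q → (p ≼ q) ⇔ (φ p ⊆ φ q)
  φ-order = proj₂ φ-copy

  descending⇒chain : ∀ {k p} → DescendingFrom k p → Chain P (suc k)
  descending⇒chain (c , _ , desc) = c , injective , comparable
    where
    injective : ∀ {i j} → c i ≡ c j → i ≡ j
    injective {i} {j} ci≡cj with <-cmp i j
    ... | tri< i<j _ _ = contradiction (desc i<j) (⊂-irref (sym (cong φ ci≡cj)))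
    ... | tri≈ _ i≡j _ = i≡j
    ... | tri> _ _ j<i = contradiction (desc j<i) (⊂-irref (cong φ ci≡cj))

    comparable : ∀ i j → c i ≼ c j ⊎ c j ≼ c i
    comparable i j with <-cmp i j
    ... | tri< i<j _ _    = inj₂ (Equivalence.from (φ-order (c j) (c i)) (proj₁ (desc i<j)))
    ... | tri≈ _ refl _   = inj₁ (IsPartialOrder.refl isPO)
    ... | tri> _ _ j<i    = inj₁ (Equivalence.from (φ-order (c i) (c j)) (proj₁ (desc j<i)))

  rank<h : ∀ p → rank p < h
  rank<h p = chains-bounded _ (descending⇒chain (descendingFrom-rank p))

  cube : Fin size → Subset n → Subset (h * n + d)
  cube p S = block h (rank p) S ++ φ p

  cube-copy : ∀ p → IsInducedCopy _⊆_ (cube p)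
  cube-copy p = injective , λ S S' → mk⇔ monotone (reflects {S} {S'})
    where
    monotone : ∀ {S S'} → S ⊆ S' → cube p S ⊆ cube p S'
    monotone S⊆S' = ++-⊆ (block-mono h (rank p) S⊆S') ⊆-refl

    reflects : ∀ {S S'} → cube p S ⊆ cube p S' → S ⊆ S'
    reflects {S} ⊆' = block-reflects h (rank p) (rank<h p) (++-⊆⁻ˡ {a = block h (rank p) S} ⊆')

    injective : ∀ {S S'} → cube p S ≡ cube p S' → S ≡ S'
    injective {S} {S'} eq = ⊆-antisym (reflects (⊆-reflexive eq)) (reflects (⊆-reflexive (sym eq)))

  transversal-copy : (S : Fin size → Subset n) → IsInducedCopy _≼_ (λ p → cube p (S p))
  transversal-copy S = injective , λ p q → mk⇔ (monotone p q) (reflects p q)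
    where
    injective : ∀ {p q} → cube p (S p) ≡ cube q (S q) → p ≡ q
    injective {p} eq = φ-injective (++-injectiveʳ (block h (rank p) (S p)) _ eq)

    monotone : ∀ p q → p ≼ q → cube p (S p) ⊆ cube q (S q)
    monotone p q p≼q with p Fin.≟ q
    ... | yes refl = ⊆-refl
    ... | no  p≢q  = ++-⊆ (block-< h (rank-mono φp⊂φq)) φp⊆φq
      where
      φp⊆φq : φ p ⊆ φ q
      φp⊆φq = Equivalence.to (φ-order p q) p≼q
      φp⊂φq : φ p ⊂ φ q
      φp⊂φq = ⊆∧≢⇒⊂ φp⊆φq (p≢q ∘ φ-injective)

    reflects : ∀ p q → cube p (S p) ⊆ cube q (S q) → p ≼ q
    reflects p q ⊆' = Equivalence.from (φ-order p q) (++-⊆⁻ʳ {a = block h (rank p) (S p)} ⊆')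

  Hits : Coloring (h * n + d) → Fin size → Set
  Hits c p = ∃ λ S → c (cube p S) ≡ colour p

  hits? : ∀ c → Decidable (Hits c)
  hits? c p = anySubset? λ S → c (cube p S) ≟ᶜ colour p

  upper-bound : EHProperty P n (h * n + d)
  upper-bound c with all? (hits? c)
  ... | yes hits = inj₁ ((λ p → cube p (proj₁ (hits p))) , transversal-copy _ , proj₂ ∘ hits)
  ... | no ¬hits with ¬∀⟶∃¬ size (Hits c) (hits? c) ¬hits
  ...   | p , miss = inj₂ (monoQ-blue⊎red {c = c} (other (colour p))
                             (cube p , cube-copy p , λ S → ≢⇒≡other (miss ∘ (S ,_))))

theorem1 : (P : ColoredPoset) → Diverse P → (n h d : ℕ) →
    IsHeight P h → IsDim2 P d →
    ((N : ℕ) → N < 2 * n → ¬ EHProperty P n N) ×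
    Σ ℕ (λ N → N ≤ h * n + d × EHProperty P n N)
theorem1 P diverse n h d (_ , chains-bounded) ((_ , φ-copy) , _) =
  lower-bound P diverse n ,
  (h * n + d , ℕ.≤-refl , Upper.upper-bound P chains-bounded φ-copy)
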